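{- For every integer $k\ge1$ and every integer $d$ with $2^k<d\le 2^{k+1}$, there is a unique (up to isomorphism) good binary tree of height $k+1$ with exactly $d$ leaves.
   Context: Good binary trees are rooted binary trees defined recursively: a good binary tree of height $0$ is a single node; for $k>0$, a good binary tree of height $k$ is a root with two children such that at most one of the two subtrees rooted at the children is a good binary tree of height $k-1$, and the remaining subtree(s) are full binary trees (every non-leaf node has exactly two children and all leaves at the same depth) of height $k-1$ or $k-2$. -}

module Defs where

open import Data.Nat using (ℕ; zero; suc; _+_)
open import Data.Product using (_×_)
open import Data.Sum using (_⊎_)

data Tree : Set where
  leaf : Tree
  node : Tree → Tree → Tree

leaves : Tree → ℕ
leaves leaf       = 1
leaves (node l r) = leaves l + leaves r

data Full : ℕ → Tree → Set where
  full-leaf : Full 0 leaf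
  full-node : ∀ {h l r} → Full h l → Full h r → Full (suc h) (node l r)

data FullOf : ℕ → Tree → Set where
  same  : ∀ {k t} → Full k t → FullOf k t
  lower : ∀ {k t} → Full k t → FullOf (suc k) t

data Good : ℕ → Tree → Set where
  good-leaf  : Good 0 leaf
  good-left  : ∀ {k l r} → Good k l → FullOf k r → Good (suc k) (node l r)
  good-right : ∀ {k l r} → FullOf k l → Good k r → Good (suc k) (node l r)

data _≅_ : Tree → Tree → Set where
  iso-leaf : leaf ≅ leaf
  iso-keep : ∀ {l r l′ r′} → l ≅ l′ → r ≅ r′ → node l r ≅ node l′ r′
  iso-swap : ∀ {l r l′ r′} → l ≅ r′ → r ≅ l′ → node l r ≅ node l′ r′

{-# OPTIONS --safe #-}
-- A good tree of height k + 1 is, up to swapping children, node g f with g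
-- good of height k and f full of height k or k - 1.  Its leaf count lies in
-- (2^(k-1), 2^k] plus 2^k or 2^(k-1), and these two ranges are disjoint; so
-- the leaf count determines f and the leaf count of g, and induction on the
-- height gives uniqueness.  Conversely every d in (2^k, 2^(k+1)] is obtained by
-- choosing f according to which of the two ranges contains d.
module Submission where

open import Defs
open import Data.Nat using (ℕ; zero; suc; _+_; _∸_; _*_; _^_; _<_; _≤_; _<?_)
open import Data.Nat.Properties
open import Data.Product using (Σ; ∃; _×_; _,_)
open import Data.Sum using (_⊎_; inj₁; inj₂)
open import Data.Empty using (⊥-elim)
open import Relation.Nullary using (yes; no)
open import Relation.Binary.PropositionalEquality

≅-refl : ∀ {t} → t ≅ t
≅-refl {leaf}     = iso-leaf
≅-refl {node l r} = iso-keep ≅-refl ≅-refl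

≅-sym : ∀ {s t} → s ≅ t → t ≅ s
≅-sym iso-leaf       = iso-leaf
≅-sym (iso-keep l r) = iso-keep (≅-sym l) (≅-sym r)
≅-sym (iso-swap l r) = iso-swap (≅-sym r) (≅-sym l)

≅-trans : ∀ {s t u} → s ≅ t → t ≅ u → s ≅ u
≅-trans iso-leaf       iso-leaf       = iso-leaf
≅-trans (iso-keep l r) (iso-keep l′ r′) = iso-keep (≅-trans l l′) (≅-trans r r′)
≅-trans (iso-keep l r) (iso-swap l′ r′) = iso-swap (≅-trans l l′) (≅-trans r r′)
≅-trans (iso-swap l r) (iso-keep l′ r′) = iso-swap (≅-trans l r′) (≅-trans r l′)
≅-trans (iso-swap l r) (iso-swap l′ r′) = iso-keep (≅-trans l r′) (≅-trans r l′)

leaves-≅ : ∀ {s t} → s ≅ t → leaves s ≡ leaves t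
leaves-≅ iso-leaf       = refl
leaves-≅ (iso-keep l r) = cong₂ _+_ (leaves-≅ l) (leaves-≅ r)
leaves-≅ (iso-swap {l′ = l′} {r′} l r) =
  trans (cong₂ _+_ (leaves-≅ l) (leaves-≅ r)) (+-comm (leaves r′) (leaves l′))

leaves-positive : ∀ t → 1 ≤ leaves t
leaves-positive leaf       = ≤-refl
leaves-positive (node l r) = ≤-trans (leaves-positive l) (m≤m+n _ _)

2*n≡n+n : ∀ n → 2 * n ≡ n + n
2*n≡n+n n = cong (n +_) (+-identityʳ n)

Full-unique : ∀ {h s t} → Full h s → Full h t → s ≡ t
Full-unique full-leaf       full-leaf         = refl
Full-unique (full-node l r) (full-node l′ r′) = cong₂ node (Full-unique l l′) (Full-unique r r′)

leaves-Full : ∀ {h t} → Full h t → leaves t ≡ 2 ^ h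
leaves-Full full-leaf           = refl
leaves-Full (full-node {h} l r) =
  trans (cong₂ _+_ (leaves-Full l) (leaves-Full r)) (sym (2*n≡n+n (2 ^ h)))

full : ∀ h → Σ Tree (Full h)
full zero = leaf , full-leaf
full (suc h) with full h
... | t , f = node t t , full-node f f

leaves-FullOf-≤ : ∀ {k t} → FullOf k t → leaves t ≤ 2 ^ k
leaves-FullOf-≤ (same f)      = ≤-reflexive (leaves-Full f)
leaves-FullOf-≤ (lower {k} f) = ≤-trans (≤-reflexive (leaves-Full f)) (m≤m+n (2 ^ k) _)

leaves-FullOf-≥ : ∀ {m t} → FullOf (suc m) t → 2 ^ m ≤ leaves t
leaves-FullOf-≥ (same {suc m} f) = ≤-trans (m≤m+n (2 ^ m) _) (≤-reflexive (sym (leaves-Full f)))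
leaves-FullOf-≥ (lower f)        = ≤-reflexive (sym (leaves-Full f))

leaves-Good-≤ : ∀ {k t} → Good k t → leaves t ≤ 2 ^ k
leaves-Good-≤ good-leaf = ≤-refl
leaves-Good-≤ (good-left {k} g f) =
  ≤-trans (+-mono-≤ (leaves-Good-≤ g) (leaves-FullOf-≤ f)) (≤-reflexive (sym (2*n≡n+n (2 ^ k))))
leaves-Good-≤ (good-right {k} f g) =
  ≤-trans (+-mono-≤ (leaves-FullOf-≤ f) (leaves-Good-≤ g)) (≤-reflexive (sym (2*n≡n+n (2 ^ k))))

leaves-Good-> : ∀ {m t} → Good (suc m) t → 2 ^ m < leaves t
leaves-Good-> {zero} (good-left {l = l} {r} _ _)  = +-mono-≤ (leaves-positive l) (leaves-positive r)
leaves-Good-> {zero} (good-right {l = l} {r} _ _) = +-mono-≤ (leaves-positive l) (leaves-positive r)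
leaves-Good-> {suc m} (good-left g f) =
  ≤-<-trans (≤-reflexive (2*n≡n+n (2 ^ m))) (+-mono-<-≤ (leaves-Good-> g) (leaves-FullOf-≥ f))
leaves-Good-> {suc m} (good-right f g) =
  ≤-<-trans (≤-reflexive (2*n≡n+n (2 ^ m))) (+-mono-≤-< (leaves-FullOf-≥ f) (leaves-Good-> g))

data GoodDecomposition (k : ℕ) (t : Tree) : Set where
  decomposition : ∀ {g f} → Good k g → FullOf k f → t ≅ node g f → GoodDecomposition k t

Good-decompose : ∀ {k t} → Good (suc k) t → GoodDecomposition k t
Good-decompose (good-left g f)  = decomposition g f ≅-refl
Good-decompose (good-right f g) = decomposition g f (iso-swap ≅-refl ≅-refl)

+-crossed-≢ : ∀ {p q g g′} → p < g → g′ ≤ q → g + q ≢ g′ + p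
+-crossed-≢ {p} {g′ = g′} p<g g′≤q eq =
  <⇒≢ (+-mono-<-≤ p<g g′≤q) (trans (+-comm p g′) (sym eq))

FullOf-determined : ∀ {k g g′ f f′} → Good k g → Good k g′ → FullOf k f → FullOf k f′ →
  leaves g + leaves f ≡ leaves g′ + leaves f′ → f ≡ f′
FullOf-determined _ _ (same f)  (same f′)  _ = Full-unique f f′
FullOf-determined _ _ (lower f) (lower f′) _ = Full-unique f f′
FullOf-determined g g′ (same f) (lower f′) eq
  rewrite leaves-Full f | leaves-Full f′ = ⊥-elim (+-crossed-≢ (leaves-Good-> g) (leaves-Good-≤ g′) eq)
FullOf-determined g g′ (lower f) (same f′) eq
  rewrite leaves-Full f | leaves-Full f′ = ⊥-elim (+-crossed-≢ (leaves-Good-> g′) (leaves-Good-≤ g) (sym eq))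

Good-unique : ∀ k {t t′} → Good k t → Good k t′ → leaves t ≡ leaves t′ → t ≅ t′
Good-unique zero good-leaf good-leaf _ = iso-leaf
Good-unique (suc k) G G′ eq with Good-decompose G | Good-decompose G′
... | decomposition {g} {f} g-good f-full t≅ | decomposition {g′} {f′} g′-good f′-full t′≅ =
  ≅-trans t≅ (≅-trans (nodes-≅ g-good g′-good f-full f′-full sums-equal) (≅-sym t′≅))
  where
  sums-equal : leaves g + leaves f ≡ leaves g′ + leaves f′
  sums-equal = trans (sym (leaves-≅ t≅)) (trans eq (leaves-≅ t′≅))

  nodes-≅ : ∀ {a a′ b b′} → Good k a → Good k a′ → FullOf k b → FullOf k b′ →
    leaves a + leaves b ≡ leaves a′ + leaves b′ → node a b ≅ node a′ b′
  nodes-≅ {a} {a′} {b} a-good a′-good b-full b′-full sums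
    with FullOf-determined a-good a′-good b-full b′-full sums
  ... | refl = iso-keep (Good-unique k a-good a′-good (+-cancelʳ-≡ (leaves b) (leaves a) (leaves a′) sums)) ≅-refl

subtract-into-interval : ∀ {a b c d} → a + b < d → d ≤ c + b →
  ∃ λ e → (a < e × e ≤ c) × e + b ≡ d
subtract-into-interval {a} {b} {c} {d} lo hi = d ∸ b , (a<e , e≤c) , d∸b+b≡d
  where
  d∸b+b≡d : d ∸ b + b ≡ d
  d∸b+b≡d = m∸n+n≡m (≤-trans (m≤n+m b a) (<⇒≤ lo))

  a<e : a < d ∸ b
  a<e = +-cancelʳ-< b a (d ∸ b) (subst (a + b <_) (sym d∸b+b≡d) lo)

  e≤c : d ∸ b ≤ c
  e≤c = +-cancelʳ-≤ b (d ∸ b) c (subst (_≤ c + b) (sym d∸b+b≡d) hi)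

split-doubling-interval : ∀ p d → 2 * p < d → d ≤ 2 * (2 * p) →
  ∃ λ e → (p < e × e ≤ 2 * p) × (e + 2 * p ≡ d ⊎ e + p ≡ d)
split-doubling-interval p d lo hi with p + 2 * p <? d
... | yes upper with subtract-into-interval upper (subst (d ≤_) (2*n≡n+n (2 * p)) hi)
...   | e , range , eq = e , range , inj₁ eq
split-doubling-interval p d lo hi
    | no ¬upper with subtract-into-interval (subst (_< d) (2*n≡n+n p) lo)
                                            (subst (d ≤_) (+-comm p (2 * p)) (≮⇒≥ ¬upper))
...   | e , range , eq = e , range , inj₂ eq

good-node : ∀ {k g} h → Good k g → (∀ {t} → Full h t → FullOf k t) →
  ∃ λ t → Good (suc k) t × leaves t ≡ leaves g + 2 ^ h
good-node {g = g} h g-good embed with full h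
... | f , f-full = node g f , good-left g-good (embed f-full) , cong (leaves g +_) (leaves-Full f-full)

Good-exists : ∀ m d → 2 ^ m < d → d ≤ 2 ^ suc m → ∃ λ t → Good (suc m) t × leaves t ≡ d
Good-exists zero d lo hi = node leaf leaf , good-left good-leaf (same full-leaf) , ≤-antisym lo hi
Good-exists (suc m) d lo hi with split-doubling-interval (2 ^ m) d lo hi
... | e , (p<e , e≤2p) , choice with Good-exists m e p<e e≤2p
...   | g , g-good , refl with choice
...     | inj₁ refl = good-node (suc m) g-good same
...     | inj₂ refl = good-node m g-good lower

claim4p1 : (k : ℕ) → 1 ≤ k → (d : ℕ) → 2 ^ k < d → d ≤ 2 ^ suc k →
    Σ Tree (λ t → (Good (suc k) t × leaves t ≡ d) ×
    ((t′ : Tree) → Good (suc k) t′ → leaves t′ ≡ d → t′ ≅ t))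
claim4p1 k _ d lo hi with Good-exists k d lo hi
... | t , t-good , t-leaves =
  t , (t-good , t-leaves) , λ t′ t′-good t′-leaves → Good-unique (suc k) t′-good t-good (trans t′-leaves (sym t-leaves))
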